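{- Let $G$ be a connected graph. Then $$H_e(G,x) = x\left(\widehat{H}_e(G,x) - |E(G)|\right) + |E(G)|.$$
   Context: For edges $e,f$ of a graph $G$, $d(e,f)$ denotes the distance between $e$ and $f$ as vertices of the line graph $L(G)$. For edges $e=ab$ and $f=xy$, set $\widehat{d}(e,f)=\min\{d(a,x),d(a,y),d(b,x),d(b,y)\}$, where $d$ on vertices is the usual shortest-path distance in $G$. For $k\ge 0$, let $d(G,k)$ be the number of unordered pairs $\{e,f\}$ of (not necessarily distinct) edges of $G$ with $d(e,f)=k$ (so $d(G,0)=|E(G)|$), and let $\widehat{d}(G,k)$ be the number of unordered pairs $\{e,f\}$ of (not necessarily distinct) edges with $\widehat{d}(e,f)=k$. The edge-Hosoya polynomial is $H_e(G,x)=\sum_{k\ge 0} d(G,k)x^k$, and its variant is $\widehat{H}_e(G,x)=\sum_{k\ge0}\widehat{d}(G,k)x^k$. -}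

module Defs where

open import Data.Nat using (ℕ; zero; suc; _<_; _≡ᵇ_; _<ᵇ_)
open import Data.Nat as ℕ using (_⊓_)
open import Data.Bool using (Bool; true; false; _∧_; _∨_; not; if_then_else_)
open import Data.Fin using (Fin; toℕ)
open import Data.List using (List; []; _∷_; _++_; map; filter; length; concatMap)
open import Data.Bool.ListAction using (any)
open import Relation.Nullary.Decidable using (T?)
open import Data.List using (allFin)
open import Data.Product using (_×_; _,_; proj₁; proj₂; Σ; ∃)
open import Data.Integer using (ℤ; +_; _-_) renaming (_+_ to _+ℤ_)
open import Relation.Binary.PropositionalEquality using (_≡_)
open import Relation.Nullary.Decidable using (does)

record Graph : Set where
  field
    n      : ℕ
    adj    : Fin n → Fin n → Bool
    sym    : ∀ a b → adj a b ≡ adj b a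
    irrefl : ∀ a → adj a a ≡ false
open Graph public

module _ {V : Set} (vs : List V) (adjV : V → V → Bool) (eqV : V → V → Bool) where
  reach : ℕ → V → V → Bool
  reach zero    a b = eqV a b
  reach (suc k) a b = reach k a b ∨ any (λ c → adjV a c ∧ reach k c b) vs

-- least k < bound with p k, and bound if there is none
search : (ℕ → Bool) → ℕ → ℕ
search p zero    = zero
search p (suc b) = if p zero then zero else suc (search (λ k → p (suc k)) b)

module _ {V : Set} (vs : List V) (adjV : V → V → Bool) (eqV : V → V → Bool) where
  -- shortest-path distance (exact whenever b is reachable from a,
  -- since shortest walks have length < |vs|)
  distance : V → V → ℕ
  distance a b = search (λ k → reach vs adjV eqV k a b) (length vs)

eqFin : ∀ {n} → Fin n → Fin n → Bool
eqFin a b = toℕ a ≡ᵇ toℕ b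

vertices : (G : Graph) → List (Fin (n G))
vertices G = allFin (n G)

reachG : (G : Graph) → ℕ → Fin (n G) → Fin (n G) → Bool
reachG G = reach (vertices G) (adj G) eqFin

Connected : Graph → Set
Connected G = ∀ a b → ∃ λ k → reachG G k a b ≡ true

dist : (G : Graph) → Fin (n G) → Fin (n G) → ℕ
dist G = distance (vertices G) (adj G) eqFin

Edge : Graph → Set
Edge G = Fin (n G) × Fin (n G)

-- E(G): each edge ab listed once, as (a , b) with a < b and a ~ b
edgeList : (G : Graph) → List (Edge G)
edgeList G = concatMap (λ a → map (λ b → (a , b))
               (filter (λ b → T? ((toℕ a <ᵇ toℕ b) ∧ adj G a b)) (vertices G)))
               (vertices G)

eqEdge : ∀ {G} → Edge G → Edge G → Bool
eqEdge (a , b) (x , y) = eqFin a x ∧ eqFin b y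

adjL : ∀ {G} → Edge G → Edge G → Bool
adjL {G} (a , b) (x , y) =
  not (eqEdge {G} (a , b) (x , y)) ∧
  (eqFin a x ∨ eqFin a y ∨ eqFin b x ∨ eqFin b y)

distL : (G : Graph) → Edge G → Edge G → ℕ
distL G = distance (edgeList G) (adjL {G}) (eqEdge {G})

distHat : (G : Graph) → Edge G → Edge G → ℕ
distHat G (a , b) (x , y) =
  dist G a x ⊓ dist G a y ⊓ dist G b x ⊓ dist G b y

-- Unordered pairs {e,f} of (not necessarily distinct) elements of a list

upairs : {A : Set} → List A → List (A × A)
upairs []       = []
upairs (x ∷ xs) = (x , x) ∷ map (λ y → (x , y)) xs ++ upairs xs

countPairs : (G : Graph) → (Edge G → Edge G → ℕ) → ℕ → ℕ
countPairs G δ k =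
  length (filter (λ p → δ (proj₁ p) (proj₂ p) ℕ.≟ k) (upairs (edgeList G)))

dG : Graph → ℕ → ℕ
dG G = countPairs G (distL G)

dHatG : Graph → ℕ → ℕ
dHatG G = countPairs G (distHat G)

numEdges : Graph → ℕ
numEdges G = length (edgeList G)

-- Polynomials with integer coefficients, as coefficient sequences
-- (p k = coefficient of x^k).

Poly : Set
Poly = ℕ → ℤ

_⊕_ : Poly → Poly → Poly
(p ⊕ q) k = p k +ℤ q k

_⊖_ : Poly → Poly → Poly
(p ⊖ q) k = p k - q k

const : ℤ → Poly
const c zero    = c
const c (suc _) = + 0

mulX : Poly → Poly
mulX p zero    = + 0
mulX p (suc k) = p k

He : Graph → Poly
He G k = + dG G k

HeHat : Graph → Poly
HeHat G k = + dHatG G k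

-- In a connected graph, two distinct edges e = ab and f = xy are at line-graph distance exactly
-- 1 + min{d(a,x), d(a,y), d(b,x), d(b,y)}: a shortest path between nearest endpoints, preceded by e
-- and followed by f, becomes a walk in L(G) whose consecutive edges share a vertex, and conversely
-- consecutive edges of a walk in L(G) share vertices, which strings together a path in G between an
-- endpoint of e and one of f that is one step shorter. Hence the pairs of distinct edges counted by
-- d(G, k+1) are exactly those counted by \hat d(G, k), while the |E(G)| pairs {e, e} have both
-- distances 0; this is the stated identity, coefficient by coefficient.
module Submission where

open import Data.Bool using (Bool; true; false; T; _∧_; _∨_)
open import Data.Bool.Properties using (T-∧; T-∨; T-≡)
open import Data.Empty using (⊥-elim)
open import Data.Fin using (Fin; toℕ)
open import Data.Fin.Properties using (toℕ-injective)
open import Data.Integer using (+_; _-_) renaming (_+_ to _+ℤ_)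
import Data.Integer.Properties as ℤ
open import Algebra.Properties.AbelianGroup ℤ.+-0-abelianGroup using (xyx⁻¹≈y)
open import Data.List using (List; []; _∷_; _++_; length; map; filter)
open import Data.List.Membership.Propositional using (_∈_; find)
open import Data.List.Membership.Propositional.Properties
  using (∈-allFin; ∈-map⁺; ∈-map⁻; ∈-filter⁺; ∈-filter⁻; ∈-concatMap⁺; ∈-concatMap⁻)
import Data.List.Membership.DecPropositional as DecMembership
open import Data.List.Properties
  using (length-++; filter-++; filter-none; filter-accept; filter-reject; length-removeAt′)
open import Data.List.Relation.Binary.Subset.Propositional using (_⊆_)
open import Data.List.Relation.Unary.All as All using (All; []; _∷_)
import Data.List.Relation.Unary.All.Properties as All
open import Data.List.Relation.Unary.AllPairs as AllPairs using ([]; _∷_)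
import Data.List.Relation.Unary.AllPairs.Properties as AllPairs
open import Data.List.Relation.Unary.Any as Any using (here; there; _─_)
open import Data.List.Relation.Unary.Any.Properties using (any⁺; any⁻)
open import Data.List.Relation.Unary.Unique.Propositional using (Unique)
import Data.List.Relation.Unary.Unique.Propositional.Properties as Unique
open import Data.Nat using (ℕ; zero; suc; _+_; _≤_; _<_; z≤n; s≤s; _⊓_; _<ᵇ_)
open import Data.Nat.Properties
  using (_≟_; ≤-trans; ≤-antisym; ≤-<-trans; m≤n⇒m≤1+n; n≤0⇒n≡0; suc-injective; 1+n≢0;
         <-cmp; <⇒<ᵇ; ≡ᵇ⇒≡; ≡⇒≡ᵇ; m⊓n≤m; m⊓n≤n; ⊓-sel; +-identityʳ)
open import Data.Nat.Solver using (module +-*-Solver)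
open import Data.Product using (_×_; _,_; proj₁; proj₂; Σ; ∃; ∃₂)
open import Data.Sum using (_⊎_; inj₁; inj₂)
open import Function using (_∘_; _⇔_; mk⇔; Equivalence)
open import Relation.Binary using (tri<; tri≈; tri>)
open import Relation.Binary.Definitions using (DecidableEquality)
open import Relation.Binary.PropositionalEquality
  using (_≡_; _≢_; refl; sym; trans; cong; cong₂; subst; ≢-sym; module ≡-Reasoning)
open import Relation.Nullary using (¬_; yes; no; contradiction)
open import Relation.Nullary.Decidable using (T?; map′)
open import Relation.Unary using (Pred; Decidable)
open import Level using (0ℓ)

open import Defs renaming (sym to adj-sym)

search-minimal : ∀ (p : ℕ → Bool) b {j} → T (p j) → search p b ≤ j
search-minimal p zero    _  = z≤n
search-minimal p (suc b) {zero} pj with p zero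
... | true  = z≤n
... | false = ⊥-elim pj
search-minimal p (suc b) {suc j} pj with p zero
... | true  = z≤n
... | false = s≤s (search-minimal (p ∘ suc) b pj)

search-found : ∀ (p : ℕ → Bool) b → search p b < b → T (p (search p b))
search-found p (suc b) lt with p zero in p0
... | true  = subst T (sym p0) _
search-found p (suc b) (s≤s lt) | false = search-found (p ∘ suc) b lt

∈-─ : ∀ {A : Set} {x y : A} {ys} → y ∈ ys → y ≢ x → (x∈ys : x ∈ ys) → y ∈ (ys ─ x∈ys)
∈-─ (here refl) y≢x (here refl) = ⊥-elim (y≢x refl)
∈-─ (there y∈)  _   (here refl) = y∈
∈-─ (here refl) _   (there _)   = here refl
∈-─ (there y∈)  y≢x (there x∈)  = there (∈-─ y∈ y≢x x∈)

unique-⊆⇒length≤ : ∀ {A : Set} {xs ys : List A} → Unique xs → xs ⊆ ys → length xs ≤ length ys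
unique-⊆⇒length≤ {xs = []}              _          _     = z≤n
unique-⊆⇒length≤ {xs = x ∷ xs} {ys} (x≢xs ∷ u) xs⊆ys =
  subst (suc (length xs) ≤_) (sym (length-removeAt′ ys (Any.index x∈ys)))
    (s≤s (unique-⊆⇒length≤ u xs⊆ys─x))
  where
    x∈ys = xs⊆ys (here refl)
    xs⊆ys─x : xs ⊆ (ys ─ x∈ys)
    xs⊆ys─x y∈ = ∈-─ (xs⊆ys (there y∈)) (≢-sym (All.lookup x≢xs y∈)) x∈ys

length-filter-cong : ∀ {B : Set} {P Q : Pred B 0ℓ} (P? : Decidable P) (Q? : Decidable Q) {xs} →
                     All (λ x → P x ⇔ Q x) xs → length (filter P? xs) ≡ length (filter Q? xs)
length-filter-cong P? Q? [] = refl
length-filter-cong P? Q? {x ∷ _} (p⇔q ∷ rest) with P? x | Q? x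
... | yes _  | yes _  = cong suc (length-filter-cong P? Q? rest)
... | no _   | no _   = length-filter-cong P? Q? rest
... | yes px | no ¬qx = contradiction (Equivalence.to p⇔q px) ¬qx
... | no ¬px | yes qx = contradiction (Equivalence.from p⇔q qx) ¬px

module Walks {V : Set} (vs : List V) (adjV eqV : V → V → Bool)
             (eqV-sound : ∀ {a b} → T (eqV a b) → a ≡ b) (eqV-refl : ∀ a → T (eqV a a)) where

  _≟V_ : DecidableEquality V
  a ≟V b = map′ eqV-sound (λ { refl → eqV-refl a }) (T? (eqV a b))

  data Walk : V → V → ℕ → Set where
    nil  : ∀ {a} → Walk a a 0
    step : ∀ {a c b l} → T (adjV a c) → c ∈ vs → Walk c b l → Walk a b (suc l)

  Walk≤ : V → V → ℕ → Set
  Walk≤ a b k = ∃ λ l → l ≤ k × Walk a b l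

  walk≤-refl : ∀ {a} → Walk≤ a a 0
  walk≤-refl = 0 , z≤n , nil

  walk≤-suc : ∀ {a b k} → Walk≤ a b k → Walk≤ a b (suc k)
  walk≤-suc (l , l≤k , w) = l , m≤n⇒m≤1+n l≤k , w

  step≤ : ∀ {a c b k} → a ≡ c ⊎ T (adjV a c) → c ∈ vs → Walk≤ c b k → Walk≤ a b (suc k)
  step≤ (inj₁ refl) _  w             = walk≤-suc w
  step≤ (inj₂ ac)   c∈ (l , l≤k , w) = suc l , s≤s l≤k , step ac c∈ w

  walk⇒reach : ∀ {a b l} → Walk a b l → T (reach vs adjV eqV l a b)
  walk⇒reach nil            = eqV-refl _
  walk⇒reach (step ac c∈ w) = Equivalence.from T-∨ (inj₂ (any⁺ _ (Any.map (λ { refl → acb }) c∈)))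
    where acb = Equivalence.from T-∧ (ac , walk⇒reach w)

  reach⇒walk : ∀ k {a b} → T (reach vs adjV eqV k a b) → Walk≤ a b k
  reach⇒walk zero r with eqV-sound r
  ... | refl = walk≤-refl
  reach⇒walk (suc k) r with Equivalence.to T-∨ r
  ... | inj₁ r′ = walk≤-suc (reach⇒walk k r′)
  ... | inj₂ r′ with find (any⁻ _ vs r′)
  ... | c , c∈ , acr with Equivalence.to T-∧ acr
  ... | ac , cr = step≤ (inj₂ ac) c∈ (reach⇒walk k cr)

  distance-≤ : ∀ {a b l} → Walk a b l → distance vs adjV eqV a b ≤ l
  distance-≤ w = search-minimal _ (length vs) (walk⇒reach w)

  distance-refl : ∀ a → distance vs adjV eqV a a ≡ 0
  distance-refl a = n≤0⇒n≡0 (distance-≤ (nil {a}))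

  visited : ∀ {a b l} → Walk a b l → List V
  visited {a} nil          = a ∷ []
  visited {a} (step _ _ w) = a ∷ visited w

  length-visited : ∀ {a b l} (w : Walk a b l) → length (visited w) ≡ suc l
  length-visited nil          = refl
  length-visited (step _ _ w) = cong suc (length-visited w)

  visited-⊆ : ∀ {a b l} → a ∈ vs → (w : Walk a b l) → visited w ⊆ vs
  visited-⊆ a∈ nil           (here refl) = a∈
  visited-⊆ a∈ (step _ _ w)  (here refl) = a∈
  visited-⊆ a∈ (step _ c∈ w) (there x∈) = visited-⊆ c∈ w x∈

  Path : V → V → Set
  Path a b = ∃ λ l → Σ (Walk a b l) (Unique ∘ visited)

  pathFrom : ∀ {a c b l} (w : Walk c b l) → a ∈ visited w → Unique (visited w) → Path a b
  pathFrom nil            (here refl) u       = _ , nil , u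
  pathFrom w@(step _ _ _) (here refl) u       = _ , w , u
  pathFrom (step _ _ w)   (there a∈)  (_ ∷ u) = pathFrom w a∈ u

  loopErase : ∀ {a b l} → Walk a b l → Path a b
  loopErase nil = 0 , nil , [] ∷ []
  loopErase {a} (step ac c∈ w) with loopErase w
  ... | _ , p , u with DecMembership._∈?_ _≟V_ a (visited p)
  ... | yes a∈ = pathFrom p a∈ u
  ... | no  a∉ = _ , step ac c∈ p , All.¬Any⇒All¬ (visited p) a∉ ∷ u

  path-length< : ∀ {a b} → a ∈ vs → ((l , p , _) : Path a b) → l < length vs
  path-length< a∈ (l , p , u) =
    subst (_≤ length vs) (length-visited p) (unique-⊆⇒length≤ u (visited-⊆ a∈ p))

  -- `distance` searches only below |vs| (returning |vs| on failure); a loop-erased walk is a path,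
  -- hence shorter than |vs|, so whenever some walk exists the search finds the true distance.
  shortestWalk : ∀ {a b l} → a ∈ vs → Walk a b l → Walk a b (distance vs adjV eqV a b)
  shortestWalk {a} {b} a∈ w with loopErase w
  ... | path@(_ , p , _) with reach⇒walk _ (search-found _ (length vs) distance<length)
    where distance<length = ≤-<-trans (distance-≤ p) (path-length< a∈ path)
  ... | l , l≤d , w′ = subst (Walk a b) (≤-antisym l≤d (distance-≤ w′)) w′

module _ {A : Set} where

  -- Chosen so that `countPairs G δ k` is literally `pairCount δ k (upairs (edgeList G))`.
  atDistance? : (δ : A → A → ℕ) (k : ℕ) → Decidable (λ p → δ (proj₁ p) (proj₂ p) ≡ k)
  atDistance? δ k p = δ (proj₁ p) (proj₂ p) ≟ k

  pairCount : (A → A → ℕ) → ℕ → List (A × A) → ℕ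
  pairCount δ k ps = length (filter (atDistance? δ k) ps)

  diagonal : List A → List (A × A)
  diagonal = map (λ x → x , x)

  offDiagonal : List A → List (A × A)
  offDiagonal []       = []
  offDiagonal (x ∷ xs) = map (x ,_) xs ++ offDiagonal xs

  pairCount-++ : ∀ δ k ps qs → pairCount δ k (ps ++ qs) ≡ pairCount δ k ps + pairCount δ k qs
  pairCount-++ δ k ps qs = trans (cong length (filter-++ _ ps qs)) (length-++ (filter _ ps))

  pairCount-upairs : ∀ δ k xs → pairCount δ k (upairs xs) ≡
                     pairCount δ k (diagonal xs) + pairCount δ k (offDiagonal xs)
  pairCount-upairs δ k []       = refl
  pairCount-upairs δ k (x ∷ xs) = begin
      pairCount δ k (((x , x) ∷ []) ++ row ++ upairs xs)
    ≡⟨ pairCount-++ δ k ((x , x) ∷ []) (row ++ upairs xs) ⟩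
      c + pairCount δ k (row ++ upairs xs)
    ≡⟨ cong (λ z → c + z) (pairCount-++ δ k row (upairs xs)) ⟩
      c + (r + pairCount δ k (upairs xs))
    ≡⟨ cong (λ z → c + (r + z)) (pairCount-upairs δ k xs) ⟩
      c + (r + (d + o))
    ≡⟨ solve 4 (λ c r d o → c :+ (r :+ (d :+ o)) := (c :+ d) :+ (r :+ o)) refl c r d o ⟩
      (c + d) + (r + o)
    ≡⟨ sym (cong₂ _+_ (pairCount-++ δ k ((x , x) ∷ []) (diagonal xs))
                       (pairCount-++ δ k row (offDiagonal xs))) ⟩
      pairCount δ k (diagonal (x ∷ xs)) + pairCount δ k (offDiagonal (x ∷ xs))
    ∎
    where
      open ≡-Reasoning
      open +-*-Solver
      row = map (x ,_) xs
      c = pairCount δ k ((x , x) ∷ [])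
      r = pairCount δ k row
      d = pairCount δ k (diagonal xs)
      o = pairCount δ k (offDiagonal xs)

  module _ {δ : A → A → ℕ} (δ-refl : ∀ x → δ x x ≡ 0) where

    pairCount-diagonal-zero : ∀ xs → pairCount δ 0 (diagonal xs) ≡ length xs
    pairCount-diagonal-zero []       = refl
    pairCount-diagonal-zero (x ∷ xs) =
      trans (cong length (filter-accept (atDistance? δ 0) (δ-refl x)))
            (cong suc (pairCount-diagonal-zero xs))

    pairCount-diagonal-suc : ∀ k xs → pairCount δ (suc k) (diagonal xs) ≡ 0
    pairCount-diagonal-suc k []       = refl
    pairCount-diagonal-suc k (x ∷ xs) =
      trans (cong length (filter-reject (atDistance? δ (suc k)) δxx≢1+k))
            (pairCount-diagonal-suc k xs)
      where δxx≢1+k = λ δxx≡1+k → 1+n≢0 (trans (sym δxx≡1+k) (δ-refl x))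

    pairCount-diagonal : ∀ xs k → + pairCount δ k (diagonal xs) ≡ const (+ length xs) k
    pairCount-diagonal xs zero    = cong +_ (pairCount-diagonal-zero xs)
    pairCount-diagonal xs (suc k) = cong +_ (pairCount-diagonal-suc k xs)

  Shifted : (A → A → ℕ) → (A → A → ℕ) → A × A → Set
  Shifted L H p = L (proj₁ p) (proj₂ p) ≡ suc (H (proj₁ p) (proj₂ p))

  module _ {L H : A → A → ℕ} {ps : List (A × A)} (L≡1+H : All (Shifted L H) ps) where

    pairCount-shift-zero : pairCount L 0 ps ≡ 0
    pairCount-shift-zero = cong length (filter-none (atDistance? L 0) (All.map l≢0 L≡1+H))
      where
        l≢0 : ∀ {l h} → l ≡ suc h → l ≢ 0
        l≢0 l≡1+h l≡0 = 1+n≢0 (trans (sym l≡1+h) l≡0)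

    pairCount-shift : ∀ k → pairCount L (suc k) ps ≡ pairCount H k ps
    pairCount-shift k =
      length-filter-cong (atDistance? L (suc k)) (atDistance? H k) (All.map shift⇔ L≡1+H)
      where
        shift⇔ : ∀ {l h} → l ≡ suc h → (l ≡ suc k) ⇔ (h ≡ k)
        shift⇔ l≡1+h = mk⇔ (λ l≡1+k → suc-injective (trans (sym l≡1+h) l≡1+k))
                           (λ h≡k → trans l≡1+h (cong suc h≡k))

  offDiagonal-distinct :
    ∀ {xs} → Unique xs → All (λ p → proj₁ p ∈ xs × proj₂ p ∈ xs × proj₁ p ≢ proj₂ p) (offDiagonal xs)
  offDiagonal-distinct {[]}     _          = []
  offDiagonal-distinct {x ∷ xs} (x≢xs ∷ u) =
    All.++⁺ (All.map⁺ (All.tabulate λ y∈ → here refl , there y∈ , All.lookup x≢xs y∈))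
            (All.map (λ (x∈ , y∈ , x≢y) → there x∈ , there y∈ , x≢y) (offDiagonal-distinct u))

module EdgeHosoya {A : Set} (L H : A → A → ℕ) (xs : List A) (xs-unique : Unique xs)
                  (L-refl : ∀ x → L x x ≡ 0) (H-refl : ∀ x → H x x ≡ 0)
                  (L≡1+H : ∀ {x y} → x ∈ xs → y ∈ xs → x ≢ y → L x y ≡ suc (H x y)) where

  private
    shifted : All (Shifted L H) (offDiagonal xs)
    shifted = All.map (λ (x∈ , y∈ , x≢y) → L≡1+H x∈ y∈ x≢y) (offDiagonal-distinct xs-unique)

  coefficient-identity :
    ∀ k → + pairCount L k (upairs xs) ≡
          (mulX ((λ j → + pairCount H j (upairs xs)) ⊖ const (+ length xs)) ⊕ const (+ length xs)) k
  coefficient-identity zero = cong +_ (begin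
      pairCount L 0 (upairs xs)
    ≡⟨ pairCount-upairs L 0 xs ⟩
      pairCount L 0 (diagonal xs) + pairCount L 0 (offDiagonal xs)
    ≡⟨ cong₂ _+_ (pairCount-diagonal-zero L-refl xs) (pairCount-shift-zero shifted) ⟩
      length xs + 0
    ≡⟨ +-identityʳ (length xs) ⟩
      length xs
    ∎)
    where open ≡-Reasoning
  coefficient-identity (suc j) = sym (begin
      (+ pairCount H j (upairs xs) - diag) +ℤ + 0
    ≡⟨ ℤ.+-identityʳ _ ⟩
      + pairCount H j (upairs xs) - diag
    ≡⟨ cong (λ z → + z - diag) (pairCount-upairs H j xs) ⟩
      + pairCount H j (diagonal xs) +ℤ + off - diag
    ≡⟨ cong (λ z → z +ℤ + off - diag) (pairCount-diagonal H-refl xs j) ⟩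
      diag +ℤ + off - diag
    ≡⟨ xyx⁻¹≈y diag (+ off) ⟩
      + off
    ≡⟨ cong +_ (sym L-count) ⟩
      + pairCount L (suc j) (upairs xs)
    ∎)
    where
      open ≡-Reasoning
      diag = const (+ length xs) j
      off = pairCount H j (offDiagonal xs)
      L-count : pairCount L (suc j) (upairs xs) ≡ off
      L-count = trans (pairCount-upairs L (suc j) xs)
                      (cong₂ _+_ (pairCount-diagonal-suc L-refl j xs) (pairCount-shift shifted j))

eqFin-sound : ∀ {m} {a b : Fin m} → T (eqFin a b) → a ≡ b
eqFin-sound {a = a} {b} t = toℕ-injective (≡ᵇ⇒≡ (toℕ a) (toℕ b) t)

eqFin-refl : ∀ {m} (a : Fin m) → T (eqFin a a)
eqFin-refl a = ≡⇒≡ᵇ (toℕ a) (toℕ a) refl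

module LineGraph (G : Graph) where

  eqEdge-sound : ∀ {g h : Edge G} → T (eqEdge {G} g h) → g ≡ h
  eqEdge-sound {a , b} {x , y} t with Equivalence.to T-∧ t
  ... | a≡x , b≡y = cong₂ _,_ (eqFin-sound a≡x) (eqFin-sound b≡y)

  eqEdge-refl : ∀ (g : Edge G) → T (eqEdge {G} g g)
  eqEdge-refl (a , b) = Equivalence.from T-∧ (eqFin-refl a , eqFin-refl b)

  module VG = Walks (vertices G) (adj G) eqFin eqFin-sound eqFin-refl
  module LG = Walks (edgeList G) (adjL {G}) (eqEdge {G}) eqEdge-sound eqEdge-refl

  infix 4 _∈ᵉ_
  _∈ᵉ_ : Fin (n G) → Edge G → Set
  u ∈ᵉ g = u ≡ proj₁ g ⊎ u ≡ proj₂ g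

  forwardNeighbour? : (a : Fin (n G)) → Decidable (λ b → T ((toℕ a <ᵇ toℕ b) ∧ adj G a b))
  forwardNeighbour? a b = T? ((toℕ a <ᵇ toℕ b) ∧ adj G a b)

  edgeRow : Fin (n G) → List (Edge G)
  edgeRow a = map (a ,_) (filter (forwardNeighbour? a) (vertices G))

  ∈-edgeList⁺ : ∀ {a b} → toℕ a < toℕ b → T (adj G a b) → (a , b) ∈ edgeList G
  ∈-edgeList⁺ {a} {b} a<b ab = ∈-concatMap⁺ edgeRow (Any.map (λ { refl → ab∈row }) (∈-allFin a))
    where
      ab∈row = ∈-map⁺ (a ,_) (∈-filter⁺ (forwardNeighbour? a) (∈-allFin b)
                                         (Equivalence.from T-∧ (<⇒<ᵇ a<b , ab)))

  ∈-edgeList⇒adj : ∀ {a b} → (a , b) ∈ edgeList G → T (adj G a b)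
  ∈-edgeList⇒adj ab∈ with find (∈-concatMap⁻ edgeRow {xs = vertices G} ab∈)
  ... | a , _ , ab∈row with ∈-map⁻ (a ,_) ab∈row
  ... | b , b∈ , refl =
    proj₂ (Equivalence.to T-∧ (proj₂ (∈-filter⁻ (forwardNeighbour? a) {xs = vertices G} b∈)))

  edgeOf-adj : ∀ {u v} → T (adj G u v) → ∃ λ g → g ∈ edgeList G × u ∈ᵉ g × v ∈ᵉ g
  edgeOf-adj {u} {v} uv with <-cmp (toℕ u) (toℕ v)
  ... | tri< u<v _ _ = (u , v) , ∈-edgeList⁺ u<v uv , inj₁ refl , inj₂ refl
  ... | tri> _ _ v<u =
    (v , u) , ∈-edgeList⁺ v<u (subst T (adj-sym G u v) uv) , inj₂ refl , inj₁ refl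
  ... | tri≈ _ u≡v _ with toℕ-injective u≡v
  ... | refl = ⊥-elim (subst T (irrefl G u) uv)

  endpoints-adj : ∀ {g u v} → g ∈ edgeList G → u ∈ᵉ g → v ∈ᵉ g → u ≡ v ⊎ T (adj G u v)
  endpoints-adj g∈ (inj₁ refl) (inj₁ refl) = inj₁ refl
  endpoints-adj g∈ (inj₂ refl) (inj₂ refl) = inj₁ refl
  endpoints-adj g∈ (inj₁ refl) (inj₂ refl) = inj₂ (∈-edgeList⇒adj g∈)
  endpoints-adj {a , b} g∈ (inj₂ refl) (inj₁ refl) =
    inj₂ (subst T (adj-sym G a b) (∈-edgeList⇒adj g∈))

  private
    ∨-introˡ : ∀ {x y} → T x → T (x ∨ y)
    ∨-introˡ = Equivalence.from T-∨ ∘ inj₁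

    ∨-introʳ : ∀ x {y} → T y → T (x ∨ y)
    ∨-introʳ _ = Equivalence.from T-∨ ∘ inj₂

  meet⇒someEndpointsEq : ∀ {a b x y u} → u ∈ᵉ (a , b) → u ∈ᵉ (x , y) →
                        T (eqFin a x ∨ eqFin a y ∨ eqFin b x ∨ eqFin b y)
  meet⇒someEndpointsEq {a} {b} (inj₁ refl) (inj₁ refl) = ∨-introˡ (eqFin-refl a)
  meet⇒someEndpointsEq {a} {b} {x} (inj₁ refl) (inj₂ refl) =
    ∨-introʳ (eqFin a x) (∨-introˡ (eqFin-refl a))
  meet⇒someEndpointsEq {a} {b} {x} {y} (inj₂ refl) (inj₁ refl) =
    ∨-introʳ (eqFin a x) (∨-introʳ (eqFin a y) (∨-introˡ (eqFin-refl b)))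
  meet⇒someEndpointsEq {a} {b} {x} {y} (inj₂ refl) (inj₂ refl) =
    ∨-introʳ (eqFin a x) (∨-introʳ (eqFin a y) (∨-introʳ (eqFin b x) (eqFin-refl b)))

  someEndpointsEq⇒meet : ∀ {a b x y} → T (eqFin a x ∨ eqFin a y ∨ eqFin b x ∨ eqFin b y) →
                        ∃ λ u → u ∈ᵉ (a , b) × u ∈ᵉ (x , y)
  someEndpointsEq⇒meet {a} {b} t with Equivalence.to T-∨ t
  ... | inj₁ a≡x = a , inj₁ refl , inj₁ (eqFin-sound a≡x)
  ... | inj₂ t′ with Equivalence.to T-∨ t′
  ... | inj₁ a≡y = a , inj₁ refl , inj₂ (eqFin-sound a≡y)
  ... | inj₂ t″ with Equivalence.to T-∨ t″
  ... | inj₁ b≡x = b , inj₂ refl , inj₁ (eqFin-sound b≡x)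
  ... | inj₂ b≡y = b , inj₂ refl , inj₂ (eqFin-sound b≡y)

  meet⇒≡⊎adjL : ∀ {g h u} → u ∈ᵉ g → u ∈ᵉ h → g ≡ h ⊎ T (adjL {G} g h)
  meet⇒≡⊎adjL {a , b} {x , y} ug uh with eqEdge {G} (a , b) (x , y) in g≡h
  ... | true  = inj₁ (eqEdge-sound (subst T (sym g≡h) _))
  ... | false = inj₂ (meet⇒someEndpointsEq ug uh)

  adjL⇒meet : ∀ {g h} → T (adjL {G} g h) → ∃ λ u → u ∈ᵉ g × u ∈ᵉ h
  adjL⇒meet {a , b} {x , y} gh = someEndpointsEq⇒meet (proj₂ (Equivalence.to T-∧ gh))

  liftWalk : ∀ {u v l g f} → f ∈ edgeList G → u ∈ᵉ g → v ∈ᵉ f → VG.Walk u v l →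
             LG.Walk≤ g f (suc l)
  liftWalk f∈ ug uf VG.nil = LG.step≤ (meet⇒≡⊎adjL ug uf) f∈ LG.walk≤-refl
  liftWalk f∈ ug vf (VG.step uc _ w) with edgeOf-adj uc
  ... | h , h∈ , uh , ch = LG.step≤ (meet⇒≡⊎adjL ug uh) h∈ (liftWalk f∈ ch vf w)

  projectWalk : ∀ {g f l} → LG.Walk g f (suc l) →
                ∃₂ λ u v → u ∈ᵉ g × v ∈ᵉ f × VG.Walk≤ u v l
  projectWalk (LG.step gf _ LG.nil) with adjL⇒meet gf
  ... | u , ug , uf = u , u , ug , uf , VG.walk≤-refl
  projectWalk (LG.step gh h∈ w@(LG.step _ _ _)) with adjL⇒meet gh | projectWalk w
  ... | s , sg , sh | u , v , uh , vf , w′ =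
    s , v , sg , vf , VG.step≤ (endpoints-adj h∈ sh uh) (∈-allFin u) w′

  distHat-≤ : ∀ {e f u v} → u ∈ᵉ e → v ∈ᵉ f → distHat G e f ≤ dist G u v
  distHat-≤ (inj₁ refl) (inj₁ refl) = ≤-trans (m⊓n≤m _ _) (≤-trans (m⊓n≤m _ _) (m⊓n≤m _ _))
  distHat-≤ (inj₁ refl) (inj₂ refl) = ≤-trans (m⊓n≤m _ _) (≤-trans (m⊓n≤m _ _) (m⊓n≤n _ _))
  distHat-≤ (inj₂ refl) (inj₁ refl) = ≤-trans (m⊓n≤m _ _) (m⊓n≤n _ _)
  distHat-≤ (inj₂ refl) (inj₂ refl) = m⊓n≤n _ _

  distHat-attained : ∀ e f → ∃₂ λ u v → u ∈ᵉ e × v ∈ᵉ f × dist G u v ≡ distHat G e f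
  distHat-attained (a , b) (x , y) with ⊓-sel (dist G a x ⊓ dist G a y ⊓ dist G b x) (dist G b y)
  ... | inj₂ ≡by = b , y , inj₂ refl , inj₂ refl , sym ≡by
  ... | inj₁ ≡₁ with ⊓-sel (dist G a x ⊓ dist G a y) (dist G b x)
  ... | inj₂ ≡bx = b , x , inj₂ refl , inj₁ refl , sym (trans ≡₁ ≡bx)
  ... | inj₁ ≡₂ with ⊓-sel (dist G a x) (dist G a y)
  ... | inj₁ ≡ax = a , x , inj₁ refl , inj₁ refl , sym (trans ≡₁ (trans ≡₂ ≡ax))
  ... | inj₂ ≡ay = a , y , inj₁ refl , inj₂ refl , sym (trans ≡₁ (trans ≡₂ ≡ay))

  lineWalk : Connected G → ∀ {e f} → f ∈ edgeList G → LG.Walk≤ e f (suc (distHat G e f))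
  lineWalk conn {e} {f} f∈ with distHat-attained e f
  ... | u , v , ue , vf , uv≡ with conn u v
  ... | k , reach-uv with VG.reach⇒walk k (Equivalence.from T-≡ reach-uv)
  ... | _ , _ , w = subst (λ d → LG.Walk≤ e f (suc d)) uv≡
                      (liftWalk f∈ ue vf (VG.shortestWalk (∈-allFin u) w))

  1+distHat≤length : ∀ {e f l} → e ≢ f → LG.Walk e f l → suc (distHat G e f) ≤ l
  1+distHat≤length e≢f LG.nil = ⊥-elim (e≢f refl)
  1+distHat≤length e≢f w@(LG.step _ _ _) with projectWalk w
  ... | u , v , ue , vf , l , l≤ , w′ =
    s≤s (≤-trans (distHat-≤ ue vf) (≤-trans (VG.distance-≤ w′) l≤))

  distL≡1+distHat : Connected G → ∀ {e f} → e ∈ edgeList G → f ∈ edgeList G → e ≢ f →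
                    distL G e f ≡ suc (distHat G e f)
  distL≡1+distHat conn e∈ f∈ e≢f with lineWalk conn f∈
  ... | l , l≤ , w =
    ≤-antisym (≤-trans (LG.distance-≤ w) l≤) (1+distHat≤length e≢f (LG.shortestWalk e∈ w))

  distHat-refl : ∀ e → distHat G e e ≡ 0
  distHat-refl (a , b) rewrite VG.distance-refl a = refl

  edgeList-unique : Unique (edgeList G)
  edgeList-unique =
    Unique.concat⁺ (All.map⁺ (All.tabulate λ _ → edgeRow-unique))
                   (AllPairs.map⁺ (AllPairs.map edgeRows-disjoint (Unique.allFin⁺ (n G))))
    where
      edgeRow-unique : ∀ {a} → Unique (edgeRow a)
      edgeRow-unique {a} =
        Unique.map⁺ (λ { refl → refl }) (Unique.filter⁺ (forwardNeighbour? a) (Unique.allFin⁺ (n G)))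

      edgeRows-disjoint : ∀ {a b} → a ≢ b → ∀ {g} → ¬ (g ∈ edgeRow a × g ∈ edgeRow b)
      edgeRows-disjoint {a} {b} a≢b (g∈a , g∈b) with ∈-map⁻ (a ,_) g∈a | ∈-map⁻ (b ,_) g∈b
      ... | _ , _ , refl | _ , _ , ab≡ = a≢b (cong proj₁ ab≡)

proposition2p2 : (G : Graph) → Connected G →
    ∀ k → He G k ≡ (mulX (HeHat G ⊖ const (+ numEdges G)) ⊕ const (+ numEdges G)) k
proposition2p2 G conn =
  EdgeHosoya.coefficient-identity (distL G) (distHat G) (edgeList G) edgeList-unique
                      LG.distance-refl distHat-refl (distL≡1+distHat conn)
  where open LineGraph G
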